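{- Let $\mathbf{X}$ and $\mathbf{Y}$ be topological spaces with carriers $X$ and $Y$, let $\mathcal U=\{U_i\}_{i\in I}$ be an indexed base of $\mathbf X$ and $\mathcal V=\{V_j\}_{j\in J}$ an indexed base of $\mathbf Y$, where $I,J\subseteq\mathbb N$, and let $f:E\to Y$ with $E\subseteq X$. If there exists a recursively enumerable $(\mathcal U,\mathcal V)$-approximation system for $f$, then $f$ is $(\mathcal U,\mathcal V)$-computable.
   Context: A $(\mathcal U,\mathcal V)$-approximation system for $f$ is a subset $R\subseteq I\times J$ such that for every $x\in E$ and every $j\in J$: $f(x)\in V_j$ if and only if there exists $i$ with $(i,j)\in R$ and $x\in U_i$. For $x\in X$ let $[x]_{\mathcal U}=\{i\in I\mid x\in U_i\}$ and for $y\in Y$ let $[y]_{\mathcal V}=\{j\in J\mid y\in V_j\}$. The function $f$ is $(\mathcal U,\mathcal V)$-computable if there exists an enumeration operator $F:\mathcal P(\mathbb N)\to\mathcal P(\mathbb N)$ such that $[f(x)]_{\mathcal V}=F([x]_{\mathcal U})$ for every $x\in E$. (An enumeration operator is a map of the form $F(M)=\{j\mid \exists\text{ finite }D\subseteq M,\ (D,j)\in W\}$ for some recursively enumerable set $W$ of pairs (canonical index of finite set, number).) -}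

module Defs where

open import Data.Nat using (ℕ; zero; suc; _<_; _%_; _/_)
open import Data.Fin using (Fin)
open import Data.Vec using (Vec; []; _∷_; lookup)
open import Data.Product using (Σ; ∃; _×_)
open import Data.Unit using (⊤)
open import Relation.Binary.PropositionalEquality using (_≡_)
open import Function.Bundles using (_⇔_)

record Topology (X : Set) : Set₁ where
  field
    Open    : (X → Set) → Set
    open-full : Open (λ _ → ⊤)
    open-∩  : ∀ {A B : X → Set} → Open A → Open B → Open (λ x → A x × B x)
    open-⋃  : ∀ {K : Set} (A : K → X → Set) → (∀ k → Open (A k))
              → Open (λ x → Σ K λ k → A k x)

record IsBase {X : Set} (T : Topology X) (I : ℕ → Set) (U : ℕ → X → Set) : Set₁ where
  open Topology T
  field
    base-open  : ∀ i → I i → Open (U i)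
    base-cover : ∀ (O : X → Set) → Open O → ∀ x → O x →
                 Σ ℕ λ i → I i × U i x × (∀ y → U i y → O y)

[_]⟨_,_⟩ : {X : Set} → X → (ℕ → Set) → (ℕ → X → Set) → ℕ → Set
[ x ]⟨ I , U ⟩ = λ i → I i × U i x

data PR : ℕ → Set where
  zer  : ∀ {n} → PR n
  succ : PR 1
  proj : ∀ {n} → Fin n → PR n
  comp : ∀ {m n} → PR m → Vec (PR n) m → PR n
  prec : ∀ {n} → PR n → PR (suc (suc n)) → PR (suc n)
  mu   : ∀ {n} → PR (suc n) → PR n

mutual
  data Eval : ∀ {n} → PR n → Vec ℕ n → ℕ → Set where
    ev-zer  : ∀ {n} {v : Vec ℕ n} → Eval zer v 0
    ev-succ : ∀ {a} → Eval succ (a ∷ []) (suc a)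
    ev-proj : ∀ {n} {k : Fin n} {v} → Eval (proj k) v (lookup v k)
    ev-comp : ∀ {m n} {g : PR m} {hs : Vec (PR n) m} {v ws y}
              → EvalAll hs v ws → Eval g ws y → Eval (comp g hs) v y
    ev-prec-z : ∀ {n} {g : PR n} {h} {v y}
              → Eval g v y → Eval (prec g h) (0 ∷ v) y
    ev-prec-s : ∀ {n} {g : PR n} {h} {k v z y}
              → Eval (prec g h) (k ∷ v) z → Eval h (k ∷ z ∷ v) y
              → Eval (prec g h) (suc k ∷ v) y
    ev-mu   : ∀ {n} {g : PR (suc n)} {v y}
              → Eval g (y ∷ v) 0
              → (∀ k → k < y → Σ ℕ λ m → Eval g (k ∷ v) (suc m))
              → Eval (mu g) v y

  data EvalAll {n} : ∀ {m} → Vec (PR n) m → Vec ℕ n → Vec ℕ m → Set where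
    []  : ∀ {v} → EvalAll [] v []
    _∷_ : ∀ {m} {h : PR n} {hs : Vec (PR n) m} {v y ys}
          → Eval h v y → EvalAll hs v ys → EvalAll (h ∷ hs) v (y ∷ ys)

RecEnum₂ : (ℕ → ℕ → Set) → Set
RecEnum₂ R = Σ (PR 2) λ φ → ∀ a b → R a b ⇔ (Σ ℕ λ y → Eval φ (a ∷ b ∷ []) y)

-- Canonical indices of finite sets: D_n = { i | bit i of n is 1 }

bit : ℕ → ℕ → ℕ
bit n zero    = n % 2
bit n (suc i) = bit (n / 2) i

CanonSub : ℕ → (ℕ → Set) → Set
CanonSub n M = ∀ i → bit n i ≡ 1 → M i

EnumOp : (ℕ → ℕ → Set) → (ℕ → Set) → ℕ → Set
EnumOp W M j = Σ ℕ λ n → CanonSub n M × W n j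

IsApproxSystem : {X Y : Set} (I J : ℕ → Set) (U : ℕ → X → Set) (V : ℕ → Y → Set)
                 (E : X → Set) (f : (x : X) → E x → Y) (R : ℕ → ℕ → Set) → Set
IsApproxSystem {X} I J U V E f R =
  (∀ i j → R i j → I i × J j) ×
  (∀ (x : X) (e : E x) j → J j → (V j (f x e) ⇔ (Σ ℕ λ i → R i j × U i x)))

IsComputable : {X Y : Set} (I J : ℕ → Set) (U : ℕ → X → Set) (V : ℕ → Y → Set)
               (E : X → Set) (f : (x : X) → E x → Y) → Set₁
IsComputable {X} I J U V E f =
  Σ (ℕ → ℕ → Set) λ W → RecEnum₂ W ×
    (∀ (x : X) (e : E x) j → [ f x e ]⟨ J , V ⟩ j ⇔ EnumOp W [ x ]⟨ I , U ⟩ j)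

module Submission where

open import Defs
open import Data.Nat using (ℕ; zero; suc; _+_; _∸_; _^_; _<_; pred; ∣_-_∣)
open import Data.Nat.Properties
open import Data.Nat.DivMod using (m*n%n≡0; m*n/n≡m; %-congˡ; /-congˡ)
open import Data.Nat.Logarithm using (⌊log₂_⌋; ⌊log₂[2^n]⌋≡n)
open import Data.Product using (Σ; _×_; _,_; proj₁; proj₂)
open import Data.Fin using (zero; suc)
open import Data.Vec using (Vec; []; _∷_)
open import Data.Empty using (⊥-elim)
open import Data.Sum using (inj₁; inj₂)
open import Relation.Binary using (tri<; tri≈; tri>)
open import Relation.Binary.PropositionalEquality
open import Function.Base using (_∘_)
open import Function.Bundles using (_⇔_; mk⇔; Equivalence)
open import Function.Definitions using (Injective)

-- Use only singleton finite sets: W = {(2^i, j) | (i, j) ∈ R}, where 2^i is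
-- the canonical index of {i}. The enumeration operator of W sends [x]_U to
-- {j | ∃ i ∈ [x]_U. R i j}, which is [f x]_V by the approximation property.
-- W is r.e. because i is recovered from 2^i by an unbounded search for the
-- root of |n - 2^i|, which is unique since 2^_ is injective.

mutual
  eval-deterministic : ∀ {n} {p : PR n} {v y y′} → Eval p v y → Eval p v y′ → y ≡ y′
  eval-deterministic ev-zer ev-zer = refl
  eval-deterministic ev-succ ev-succ = refl
  eval-deterministic ev-proj ev-proj = refl
  eval-deterministic (ev-comp hs g) (ev-comp hs′ g′)
    rewrite evalAll-deterministic hs hs′ = eval-deterministic g g′
  eval-deterministic (ev-prec-z g) (ev-prec-z g′) = eval-deterministic g g′
  eval-deterministic (ev-prec-s r h) (ev-prec-s r′ h′)
    rewrite eval-deterministic r r′ = eval-deterministic h h′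
  eval-deterministic (ev-mu {y = y} z below) (ev-mu {y = y′} z′ below′) with <-cmp y y′
  ... | tri< y<y′ _ _ = ⊥-elim (0≢1+n (eval-deterministic z (proj₂ (below′ y y<y′))))
  ... | tri≈ _ y≡y′ _ = y≡y′
  ... | tri> _ _ y′<y = ⊥-elim (0≢1+n (eval-deterministic z′ (proj₂ (below y′ y′<y))))

  evalAll-deterministic : ∀ {n m} {hs : Vec (PR n) m} {v ys ys′} →
                          EvalAll hs v ys → EvalAll hs v ys′ → ys ≡ ys′
  evalAll-deterministic [] [] = refl
  evalAll-deterministic (h ∷ hs) (h′ ∷ hs′) =
    cong₂ _∷_ (eval-deterministic h h′) (evalAll-deterministic hs hs′)

Computes₁ : PR 1 → (ℕ → ℕ) → Set
Computes₁ p g = ∀ a → Eval p (a ∷ []) (g a)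

Computes₂ : PR 2 → (ℕ → ℕ → ℕ) → Set
Computes₂ p g = ∀ a b → Eval p (a ∷ b ∷ []) (g a b)

predₚ : PR 1
predₚ = prec zer (proj zero)

predₚ-computes : Computes₁ predₚ pred
predₚ-computes zero    = ev-prec-z ev-zer
predₚ-computes (suc a) = ev-prec-s (predₚ-computes a) ev-proj

addₚ : PR 2
addₚ = prec (proj zero) (comp succ (proj (suc zero) ∷ []))

addₚ-computes : Computes₂ addₚ _+_
addₚ-computes zero    b = ev-prec-z ev-proj
addₚ-computes (suc a) b = ev-prec-s (addₚ-computes a b) (ev-comp (ev-proj ∷ []) ev-succ)

-- The recursion runs on the first argument, so this is flipped monus.
monusₚ : PR 2
monusₚ = prec (proj zero) (comp predₚ (proj (suc zero) ∷ []))

monusₚ-computes : Computes₂ monusₚ (λ a b → b ∸ a)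
monusₚ-computes zero    b = ev-prec-z ev-proj
monusₚ-computes (suc a) b =
  subst (Eval monusₚ (suc a ∷ b ∷ [])) (pred[m∸n]≡m∸[1+n] b a)
    (ev-prec-s (monusₚ-computes a b) (ev-comp (ev-proj ∷ []) (predₚ-computes (b ∸ a))))

pow2ₚ : PR 1
pow2ₚ = prec (comp succ (zer ∷ [])) (comp addₚ (proj (suc zero) ∷ proj (suc zero) ∷ []))

pow2ₚ-computes : Computes₁ pow2ₚ (2 ^_)
pow2ₚ-computes zero    = ev-prec-z (ev-comp (ev-zer ∷ []) ev-succ)
pow2ₚ-computes (suc i) =
  subst (Eval pow2ₚ (suc i ∷ [])) (cong (2 ^ i +_) (sym (+-identityʳ (2 ^ i))))
    (ev-prec-s (pow2ₚ-computes i)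
      (ev-comp (ev-proj ∷ ev-proj ∷ []) (addₚ-computes (2 ^ i) (2 ^ i))))

∣m-n∣≡m∸n+n∸m : ∀ m n → ∣ m - n ∣ ≡ (m ∸ n) + (n ∸ m)
∣m-n∣≡m∸n+n∸m m n with ≤-total m n
... | inj₁ m≤n rewrite m≤n⇒m∸n≡0 m≤n = m≤n⇒∣m-n∣≡n∸m m≤n
... | inj₂ n≤m rewrite m≤n⇒m∸n≡0 n≤m | ∣-∣-comm m n =
  trans (m≤n⇒∣m-n∣≡n∸m n≤m) (sym (+-identityʳ (m ∸ n)))

module Inverse {g : ℕ → ℕ} (p : PR 1) (p-computes : Computes₁ p g) where

  -- Arguments (i, n, j): the extra argument j is carried along and ignored.
  distanceₚ : PR 3
  distanceₚ = comp addₚ (comp monusₚ (gᵢ ∷ n ∷ []) ∷ comp monusₚ (n ∷ gᵢ ∷ []) ∷ [])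
    where
    gᵢ n : PR 3
    gᵢ = comp p (proj zero ∷ [])
    n  = proj (suc zero)

  distanceₚ-computes : ∀ i n j → Eval distanceₚ (i ∷ n ∷ j ∷ []) ∣ n - g i ∣
  distanceₚ-computes i n j =
    subst (Eval distanceₚ (i ∷ n ∷ j ∷ [])) (sym (∣m-n∣≡m∸n+n∸m n (g i)))
      (ev-comp (ev-comp (gᵢ ∷ ev-proj ∷ []) (monusₚ-computes (g i) n)
              ∷ ev-comp (ev-proj ∷ gᵢ ∷ []) (monusₚ-computes n (g i)) ∷ [])
        (addₚ-computes (n ∸ g i) (g i ∸ n)))
    where
    gᵢ : Eval (comp p (proj zero ∷ [])) (i ∷ n ∷ j ∷ []) (g i)
    gᵢ = ev-comp (ev-proj ∷ []) (p-computes i)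

  inverseₚ : PR 2
  inverseₚ = mu distanceₚ

  inverseₚ-sound : ∀ {n j i} → Eval inverseₚ (n ∷ j ∷ []) i → n ≡ g i
  inverseₚ-sound {n} {j} {i} (ev-mu root _) =
    ∣m-n∣≡0⇒m≡n (eval-deterministic (distanceₚ-computes i n j) root)

  inverseₚ-complete : Injective _≡_ _≡_ g → ∀ i j → Eval inverseₚ (g i ∷ j ∷ []) i
  inverseₚ-complete g-injective i j =
    ev-mu (subst (Eval distanceₚ (i ∷ g i ∷ j ∷ [])) (∣n-n∣≡0 (g i)) (distanceₚ-computes i (g i) j))
          no-earlier-root
    where
    no-earlier-root : ∀ k → k < i → Σ ℕ λ m → Eval distanceₚ (k ∷ g i ∷ j ∷ []) (suc m)
    no-earlier-root k k<i with ∣ g i - g k ∣ in d | distanceₚ-computes k (g i) j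
    ... | zero  | _ = ⊥-elim (<-irrefl (sym (g-injective (∣m-n∣≡0⇒m≡n d))) k<i)
    ... | suc m | e = m , e

MapFst : (ℕ → ℕ) → (ℕ → ℕ → Set) → ℕ → ℕ → Set
MapFst g R n j = Σ ℕ λ i → n ≡ g i × R i j

recEnum₂-mapFst : ∀ {g R} (p : PR 1) → Computes₁ p g → Injective _≡_ _≡_ g →
                  RecEnum₂ R → RecEnum₂ (MapFst g R)
recEnum₂-mapFst {g} {R} p p-computes g-injective (φ , φ-domain) =
  ψ , λ n j → mk⇔ (halts n j) (in-image n j)
  where
  open Inverse p p-computes
  ψ : PR 2
  ψ = comp φ (inverseₚ ∷ proj (suc zero) ∷ [])

  halts : ∀ n j → MapFst g R n j → Σ ℕ λ y → Eval ψ (n ∷ j ∷ []) y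
  halts .(g i) j (i , refl , Rij) =
    let y , φ-halts = Equivalence.to (φ-domain i j) Rij
    in  y , ev-comp (inverseₚ-complete g-injective i j ∷ ev-proj ∷ []) φ-halts

  in-image : ∀ n j → (Σ ℕ λ y → Eval ψ (n ∷ j ∷ []) y) → MapFst g R n j
  in-image n j (y , ev-comp {ws = i ∷ _} (inverse ∷ ev-proj ∷ []) φ-halts) =
    i , inverseₚ-sound inverse , Equivalence.from (φ-domain i j) (y , φ-halts)

2^-injective : Injective _≡_ _≡_ (2 ^_)
2^-injective {m} {n} eq =
  trans (sym (⌊log₂[2^n]⌋≡n m)) (trans (cong ⌊log₂_⌋ eq) (⌊log₂[2^n]⌋≡n n))

bit-0 : ∀ k → bit 0 k ≡ 0
bit-0 zero    = refl
bit-0 (suc k) = bit-0 k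

bit-2^[1+i]-zero : ∀ i → bit (2 ^ suc i) zero ≡ 0
bit-2^[1+i]-zero i = trans (%-congˡ (*-comm 2 (2 ^ i))) (m*n%n≡0 (2 ^ i) 2)

bit-2^[1+i]-suc : ∀ i k → bit (2 ^ suc i) (suc k) ≡ bit (2 ^ i) k
bit-2^[1+i]-suc i k = cong (λ m → bit m k) (trans (/-congˡ (*-comm 2 (2 ^ i))) (m*n/n≡m (2 ^ i) 2))

bit-2^-self : ∀ i → bit (2 ^ i) i ≡ 1
bit-2^-self zero    = refl
bit-2^-self (suc i) = trans (bit-2^[1+i]-suc i i) (bit-2^-self i)

bit-2^⇒≡ : ∀ i k → bit (2 ^ i) k ≡ 1 → k ≡ i
bit-2^⇒≡ zero    zero    _  = refl
bit-2^⇒≡ zero    (suc k) eq = ⊥-elim (0≢1+n (trans (sym (bit-0 k)) eq))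
bit-2^⇒≡ (suc i) zero    eq = ⊥-elim (0≢1+n (trans (sym (bit-2^[1+i]-zero i)) eq))
bit-2^⇒≡ (suc i) (suc k) eq = cong suc (bit-2^⇒≡ i k (trans (sym (bit-2^[1+i]-suc i k)) eq))

canonSub-2^ : ∀ {M} i → CanonSub (2 ^ i) M ⇔ M i
canonSub-2^ {M} i = mk⇔ (λ sub → sub i (bit-2^-self i))
                        (λ Mi k bitk → subst M (sym (bit-2^⇒≡ i k bitk)) Mi)

enumOp-mapFst-2^ : ∀ R M j → EnumOp (MapFst (2 ^_) R) M j ⇔ (Σ ℕ λ i → R i j × M i)
enumOp-mapFst-2^ R M j = mk⇔ to from
  where
  to : EnumOp (MapFst (2 ^_) R) M j → Σ ℕ λ i → R i j × M i
  to (.(2 ^ i) , sub , i , refl , Rij) = i , Rij , Equivalence.to (canonSub-2^ i) sub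
  from : (Σ ℕ λ i → R i j × M i) → EnumOp (MapFst (2 ^_) R) M j
  from (i , Rij , Mi) = 2 ^ i , Equivalence.from (canonSub-2^ i) Mi , i , refl , Rij

theorem2p9 : {X Y : Set} (TX : Topology X) (TY : Topology Y)
    (I J : ℕ → Set) (U : ℕ → X → Set) (V : ℕ → Y → Set)
    → IsBase TX I U → IsBase TY J V
    → (E : X → Set) (f : (x : X) → E x → Y)
    → Σ (ℕ → ℕ → Set) (λ R → IsApproxSystem I J U V E f R × RecEnum₂ R)
    → IsComputable I J U V E f
theorem2p9 _ _ I J U V _ _ E f (R , (R⊆I×J , approx) , R-re) =
  MapFst (2 ^_) R , recEnum₂-mapFst pow2ₚ pow2ₚ-computes 2^-injective R-re ,
  λ x e j → mk⇔ (Equivalence.from (enumOp-mapFst-2^ R _ j) ∘ witness x e j)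
                (image x e j ∘ Equivalence.to (enumOp-mapFst-2^ R _ j))
  where
  witness : ∀ x e j → [ f x e ]⟨ J , V ⟩ j → Σ ℕ λ i → R i j × [ x ]⟨ I , U ⟩ i
  witness x e j (Jj , Vj) =
    let i , Rij , Uix = Equivalence.to (approx x e j Jj) Vj
    in  i , Rij , proj₁ (R⊆I×J i j Rij) , Uix

  image : ∀ x e j → (Σ ℕ λ i → R i j × [ x ]⟨ I , U ⟩ i) → [ f x e ]⟨ J , V ⟩ j
  image x e j (i , Rij , _ , Uix) =
    let Jj = proj₂ (R⊆I×J i j Rij)
    in  Jj , Equivalence.from (approx x e j Jj) (i , Rij , Uix)
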